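{- Let $G$ be a $P_6$-free graph with clique number $k \geq 2$, let $X$ be a minimal separator of $G$, and let $A$ and $B$ be two distinct full components of $X$. Then there exists a set $Q \subseteq A$ with $|Q| \leq k$ such that every vertex of $X \setminus N(Q)$ is adjacent to every vertex of $B$.
   Context: All graphs are finite and simple. A graph is $P_6$-free if it has no induced subgraph isomorphic to the path on $6$ vertices. The clique number of $G$ is the maximum cardinality of a set of pairwise adjacent vertices. For $X \subseteq V(G)$, a connected component $C$ of $G - X$ is a full component of $X$ if $N_G(C) = X$, i.e., every vertex of $X$ has a neighbor in $C$. A set $X$ is a minimal separator if it has at least two full components. $N(Q)$ denotes the set of vertices of $G$ adjacent to at least one vertex of $Q$. -}

module Defs where

open import Data.Nat using (ℕ; _≤_)
open import Data.Fin using (Fin; zero; suc)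
open import Data.Fin.Subset using (Subset; _∈_; _∉_; _⊆_; ∣_∣)
open import Data.Bool using (Bool; true; false)
open import Data.Product using (Σ; ∃; _×_; _,_)
open import Function.Definitions using (Injective)
open import Relation.Binary.PropositionalEquality using (_≡_; _≢_)
open import Relation.Nullary using (¬_)

record Graph (n : ℕ) : Set where
  field
    adj    : Fin n → Fin n → Bool
    sym    : ∀ u v → adj u v ≡ adj v u
    irrefl : ∀ v → adj v v ≡ false

module _ {n : ℕ} (G : Graph n) where
  open Graph G

  Edge : Fin n → Fin n → Set
  Edge u v = adj u v ≡ true

  PathAdj : Fin 6 → Fin 6 → Set
  PathAdj i j = (Data.Fin.toℕ i Data.Nat.+ 1 ≡ Data.Fin.toℕ j)
              Data.Sum.⊎ (Data.Fin.toℕ j Data.Nat.+ 1 ≡ Data.Fin.toℕ i)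
    where import Data.Sum

  InducedP6 : Set
  InducedP6 = Σ (Fin 6 → Fin n) λ f →
    Injective _≡_ _≡_ f ×
    (∀ i j → (Edge (f i) (f j) → PathAdj i j) × (PathAdj i j → Edge (f i) (f j)))

  P6Free : Set
  P6Free = ¬ InducedP6

  IsClique : Subset n → Set
  IsClique S = ∀ u v → u ∈ S → v ∈ S → u ≢ v → Edge u v

  CliqueNumber : ℕ → Set
  CliqueNumber k = (Σ (Subset n) λ S → IsClique S × ∣ S ∣ ≡ k)
                 × (∀ S → IsClique S → ∣ S ∣ ≤ k)

  data WalkIn (S : Subset n) : Fin n → Fin n → Set where
    here : ∀ {u} → u ∈ S → WalkIn S u u
    step : ∀ {u v w} → u ∈ S → Edge u v → WalkIn S v w → WalkIn S u w

  IsComponentOf : Subset n → Subset n → Set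
  IsComponentOf X C =
      (Σ (Fin n) λ c → c ∈ C)
    × (∀ v → v ∈ C → v ∉ X)
    × (∀ u v → u ∈ C → v ∈ C → WalkIn C u v)
    × (∀ u v → u ∈ C → Edge u v → v ∉ X → v ∈ C)

  InNbhd : Subset n → Fin n → Set
  InNbhd Q v = Σ (Fin n) λ q → q ∈ Q × Edge v q

  -- C is a full component of X: a component of G - X with N(C) = X,
  -- i.e. every vertex of X has a neighbour in C (N(C) ⊆ X holds for any component)
  IsFullComponent : Subset n → Subset n → Set
  IsFullComponent X C = IsComponentOf X C × (∀ x → x ∈ X → InNbhd C x)

  -- X is a minimal separator: it has at least two (distinct) full components
  IsMinimalSeparator : Subset n → Set
  IsMinimalSeparator X = Σ (Subset n) λ C₁ → Σ (Subset n) λ C₂ →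
    C₁ ≢ C₂ × IsFullComponent X C₁ × IsFullComponent X C₂

module Submission where

-- Grow a clique Q ⊆ A greedily, keeping the invariant that every vertex y ∈ X ∖ N(Q) with a
-- non-neighbour in B has a neighbour in A complete to Q. Adding such a neighbour a preserves
-- the invariant: otherwise some y has an induced P4 y p q a inside A, and since y has a
-- non-neighbour in the connected full component B there are b₁ ~ b₂ in B with y ~ b₁, y ≁ b₂,
-- so b₂ b₁ y p q a is an induced P6. The growth stops once X ∖ N(Q) is complete to B, and
-- |Q| ≤ k because Q is a clique.

open import Defs
open import Data.Nat using (ℕ; zero; suc; _+_; _≤_)
open import Data.Nat.Properties using (≤-trans; +-suc; +-monoʳ-≤; m≤m+n; <⇒≱; _≟_; suc-injective)
open import Data.Fin using (Fin; zero; suc; toℕ)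
import Data.Fin as Fin
open import Data.Fin.Properties using (any?; all?)
open import Data.Fin.Subset using (Subset; _∈_; _∉_; _⊆_; _⊂_; ∣_∣; _∪_; ⁅_⁆; ⊥)
open import Data.Fin.Subset.Properties
  using (_∈?_; nonempty?; ⊆-antisym; x∈p∪q⁻; p⊆p∪q; q⊆p∪q; x∈⁅x⁆; x∈⁅y⁆⇒x≡y; p⊂q⇒∣p∣<∣q∣; ∣p∣≤n; ∉⊥)
open import Data.Vec using (Vec; []; _∷_; lookup)
open import Data.Vec.Relation.Unary.All using (All; []; _∷_)
open import Data.Vec.Relation.Unary.All.Properties using (lookup⁺)
open import Data.Bool using (true)
import Data.Bool.Properties as Bool
open import Data.Product using (Σ; ∃; _×_; _,_; proj₁; proj₂)
open import Data.Sum using (_⊎_; inj₁; inj₂; [_,_]′)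
import Data.Sum as Sum
open import Data.Empty using (⊥-elim)
open import Function using (_∘_)
open import Relation.Binary.PropositionalEquality using (_≡_; _≢_; refl; sym; trans; subst; cong)
open import Relation.Nullary using (¬_; Dec; yes; no; contradiction)
open import Relation.Nullary.Decidable using (_×-dec_; _⊎-dec_; _→-dec_; ¬?; toWitness; decidable-stable)

Consecutive : ∀ {m} → Fin m → Fin m → Set
Consecutive i j = toℕ i + 1 ≡ toℕ j ⊎ toℕ j + 1 ≡ toℕ i

consecutive? : ∀ {m} (i j : Fin m) → Dec (Consecutive i j)
consecutive? i j = (toℕ i + 1 ≟ toℕ j) ⊎-dec (toℕ j + 1 ≟ toℕ i)

consecutive-suc⁺ : ∀ {m} {i j : Fin m} → Consecutive i j → Consecutive (suc i) (suc j)
consecutive-suc⁺ = Sum.map (cong suc) (cong suc)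

consecutive-suc⁻ : ∀ {m} {i j : Fin m} → Consecutive (suc i) (suc j) → Consecutive i j
consecutive-suc⁻ = Sum.map suc-injective suc-injective

P6-neighbourhood-injective : ∀ (i j : Fin 6) →
  (∀ l → Consecutive i l → Consecutive j l) → (∀ l → Consecutive j l → Consecutive i l) → i ≡ j
P6-neighbourhood-injective = toWitness {a? = all? λ i → all? λ j →
  all? (λ l → consecutive? i l →-dec consecutive? j l) →-dec
  all? (λ l → consecutive? j l →-dec consecutive? i l) →-dec (i Fin.≟ j)} _

module _ {n : ℕ} where

  ∈-∪⁅⁆⁻ : ∀ {Q : Subset n} {a x} → x ∈ Q ∪ ⁅ a ⁆ → x ∈ Q ⊎ x ≡ a
  ∈-∪⁅⁆⁻ {Q} {a} x∈Q∪a = Sum.map₂ (x∈⁅y⁆⇒x≡y a) (x∈p∪q⁻ Q ⁅ a ⁆ x∈Q∪a)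

  ⊂-∪⁅⁆ : ∀ {Q : Subset n} {a} → a ∉ Q → Q ⊂ Q ∪ ⁅ a ⁆
  ⊂-∪⁅⁆ {Q} {a} a∉Q = p⊆p∪q ⁅ a ⁆ , a , q⊆p∪q Q ⁅ a ⁆ (x∈⁅x⁆ a) , a∉Q

  module _ {P R : Subset n → Set} (resolve-or-grow : ∀ Q → P Q → R Q ⊎ ∃ λ Q′ → P Q′ × Q ⊂ Q′) where

    saturate : ∀ Q → P Q → ∃ λ Q → P Q × R Q
    saturate Q PQ = go n Q PQ (m≤m+n n ∣ Q ∣)
      where
      go : ∀ fuel Q → P Q → n ≤ fuel + ∣ Q ∣ → ∃ λ Q → P Q × R Q
      go fuel Q PQ n≤ with resolve-or-grow Q PQ
      ... | inj₁ RQ = Q , PQ , RQ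
      go zero Q PQ n≤ | inj₂ (Q′ , _ , Q⊂Q′) = ⊥-elim (<⇒≱ (p⊂q⇒∣p∣<∣q∣ Q⊂Q′) (≤-trans (∣p∣≤n Q′) n≤))
      go (suc fuel) Q PQ n≤ | inj₂ (Q′ , PQ′ , Q⊂Q′) =
        go fuel Q′ PQ′ (≤-trans n≤ (subst (_≤ fuel + ∣ Q′ ∣) (+-suc fuel ∣ Q ∣)
                                          (+-monoʳ-≤ fuel (p⊂q⇒∣p∣<∣q∣ Q⊂Q′))))

module _ {n : ℕ} (G : Graph n) where

  Edge-sym : ∀ {u v} → Edge G u v → Edge G v u
  Edge-sym {u} {v} = trans (Graph.sym G v u)

  Edge-irrefl : ∀ {v} → ¬ Edge G v v
  Edge-irrefl {v} e with trans (sym (Graph.irrefl G v)) e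
  ... | ()

  Edge? : ∀ u v → Dec (Edge G u v)
  Edge? u v = Graph.adj G u v Bool.≟ true

  data IsInducedPath : ∀ {m} → Vec (Fin n) (suc m) → Set where
    [_] : ∀ v → IsInducedPath (v ∷ [])
    step : ∀ {m u v} {vs : Vec (Fin n) m} →
      Edge G u v → All (¬_ ∘ Edge G u) vs → IsInducedPath (v ∷ vs) → IsInducedPath (u ∷ v ∷ vs)

  edge⇒consecutive : ∀ {m} {vs : Vec (Fin n) (suc m)} → IsInducedPath vs →
    ∀ i j → Edge G (lookup vs i) (lookup vs j) → Consecutive i j
  edge⇒consecutive _ zero zero e = ⊥-elim (Edge-irrefl e)
  edge⇒consecutive (step _ _ _) zero (suc zero) _ = inj₁ refl
  edge⇒consecutive (step _ ≁vs _) zero (suc (suc j)) e = ⊥-elim (lookup⁺ ≁vs j e)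
  edge⇒consecutive (step _ _ _) (suc zero) zero _ = inj₂ refl
  edge⇒consecutive (step _ ≁vs _) (suc (suc i)) zero e = ⊥-elim (lookup⁺ ≁vs i (Edge-sym e))
  edge⇒consecutive (step _ _ path) (suc i) (suc j) e = consecutive-suc⁺ (edge⇒consecutive path i j e)

  consecutive⇒edge : ∀ {m} {vs : Vec (Fin n) (suc m)} → IsInducedPath vs →
    ∀ i j → Consecutive i j → Edge G (lookup vs i) (lookup vs j)
  consecutive⇒edge _ zero zero (inj₁ ())
  consecutive⇒edge _ zero zero (inj₂ ())
  consecutive⇒edge (step u~v _ _) zero (suc zero) _ = u~v
  consecutive⇒edge _ zero (suc (suc _)) (inj₁ ())
  consecutive⇒edge _ zero (suc (suc _)) (inj₂ ())
  consecutive⇒edge (step u~v _ _) (suc zero) zero _ = Edge-sym u~v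
  consecutive⇒edge _ (suc (suc _)) zero (inj₁ ())
  consecutive⇒edge _ (suc (suc _)) zero (inj₂ ())
  consecutive⇒edge (step _ _ path) (suc i) (suc j) c = consecutive⇒edge path i j (consecutive-suc⁻ c)

  -- PathAdj G is definitionally Consecutive on Fin 6.
  inducedP6 : {vs : Vec (Fin n) 6} → IsInducedPath vs → InducedP6 G
  inducedP6 {vs} path = lookup vs , injective , λ i j → edge⇒consecutive path i j , consecutive⇒edge path i j
    where
    injective : ∀ {i j} → lookup vs i ≡ lookup vs j → i ≡ j
    injective {i} {j} vᵢ≡vⱼ = P6-neighbourhood-injective i j
      (λ l → edge⇒consecutive path j l ∘ subst (λ v → Edge G v (lookup vs l)) vᵢ≡vⱼ ∘ consecutive⇒edge path i l)
      (λ l → edge⇒consecutive path i l ∘ subst (λ v → Edge G v (lookup vs l)) (sym vᵢ≡vⱼ) ∘ consecutive⇒edge path j l)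

  walk-start : ∀ {S u v} → WalkIn G S u v → u ∈ S
  walk-start (here u∈S) = u∈S
  walk-start (step u∈S _ _) = u∈S

  walk-exit : ∀ {S u v} (P : Fin n → Set) → (∀ w → Dec (P w)) → WalkIn G S u v → P u → ¬ P v →
    ∃ λ w → ∃ λ w′ → w ∈ S × w′ ∈ S × Edge G w w′ × P w × ¬ P w′
  walk-exit P P? (here _) Pu ¬Pv = ⊥-elim (¬Pv Pu)
  walk-exit P P? (step {v = v} u∈S u~v walk) Pu ¬Pw with P? v
  ... | yes Pv = walk-exit P P? walk Pv ¬Pw
  ... | no ¬Pv = _ , v , u∈S , walk-start walk , u~v , Pu , ¬Pv

  walk-stays : ∀ {X C D u v} → WalkIn G C u v → (∀ w → w ∈ C → w ∉ X) →
    (∀ w w′ → w ∈ D → Edge G w w′ → w′ ∉ X → w′ ∈ D) → u ∈ D → v ∈ D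
  walk-stays (here _) _ _ u∈D = u∈D
  walk-stays (step _ u~v walk) C∩X=∅ D-closed u∈D =
    walk-stays walk C∩X=∅ D-closed (D-closed _ _ u∈D u~v (C∩X=∅ _ (walk-start walk)))

  module _ {X C D : Subset n} (C-comp : IsComponentOf G X C) (D-comp : IsComponentOf G X D) where

    components-disjoint : C ≢ D → ∀ {v} → v ∈ C → v ∉ D
    components-disjoint C≢D {v} v∈C v∈D =
      C≢D (⊆-antisym (spread C-comp D-comp v∈C v∈D) (spread D-comp C-comp v∈D v∈C))
      where
      spread : ∀ {C D} → IsComponentOf G X C → IsComponentOf G X D → v ∈ C → v ∈ D → C ⊆ D
      spread (_ , C∩X=∅ , C-connected , _) (_ , _ , _ , D-closed) v∈C v∈D {u} u∈C =
        walk-stays (C-connected v u v∈C u∈C) C∩X=∅ D-closed v∈D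

    components-anticomplete : C ≢ D → ∀ {c d} → c ∈ C → d ∈ D → ¬ Edge G c d
    components-anticomplete C≢D {c} {d} c∈C d∈D c~d = components-disjoint C≢D d∈C d∈D
      where
      d∈C : d ∈ C
      d∈C = let (_ , _ , _ , C-closed) = C-comp ; (_ , D∩X=∅ , _ , _) = D-comp in
        C-closed c d c∈C c~d (D∩X=∅ d d∈D)

  HangingEdge : Subset n → Fin n → Set
  HangingEdge B y = ∃ λ b₁ → ∃ λ b₂ → b₁ ∈ B × b₂ ∈ B × Edge G y b₁ × Edge G b₁ b₂ × ¬ Edge G y b₂

  hangingEdge : ∀ {X B y b} → IsFullComponent G X B → y ∈ X → b ∈ B → ¬ Edge G y b → HangingEdge B y
  hangingEdge {y = y} ((_ , _ , B-connected , _) , B-full) y∈X b∈B y≁b with B-full y y∈X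
  ... | c , c∈B , y~c with walk-exit (Edge G y) (Edge? y) (B-connected c _ c∈B b∈B) y~c y≁b
  ... | b₁ , b₂ , b₁∈B , b₂∈B , b₁~b₂ , y~b₁ , y≁b₂ = b₁ , b₂ , b₁∈B , b₂∈B , y~b₁ , b₁~b₂ , y≁b₂

  inNbhd? : ∀ Q y → Dec (InNbhd G Q y)
  inNbhd? Q y = any? λ q → (q ∈? Q) ×-dec Edge? y q

  ∉N-∪⁅⁆⁻ : ∀ {Q a y} → ¬ InNbhd G (Q ∪ ⁅ a ⁆) y → ¬ InNbhd G Q y × ¬ Edge G y a
  ∉N-∪⁅⁆⁻ {Q} {a} y∉N =
    (λ (q , q∈Q , y~q) → y∉N (q , p⊆p∪q ⁅ a ⁆ q∈Q , y~q)) ,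
    (λ y~a → y∉N (a , q⊆p∪q Q ⁅ a ⁆ (x∈⁅x⁆ a) , y~a))

  CompleteTo : Subset n → Fin n → Set
  CompleteTo Q p = ∀ q → q ∈ Q → Edge G p q

  completeTo-∪⁅⁆ : ∀ {Q a p} → CompleteTo Q p → Edge G p a → CompleteTo (Q ∪ ⁅ a ⁆) p
  completeTo-∪⁅⁆ p→Q p~a q q∈Q∪a with ∈-∪⁅⁆⁻ q∈Q∪a
  ... | inj₁ q∈Q = p→Q q q∈Q
  ... | inj₂ refl = p~a

  isClique-∪⁅⁆ : ∀ {Q a} → IsClique G Q → CompleteTo Q a → IsClique G (Q ∪ ⁅ a ⁆)
  isClique-∪⁅⁆ Q-clique a→Q u v u∈ v∈ u≢v with ∈-∪⁅⁆⁻ u∈ | ∈-∪⁅⁆⁻ v∈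
  ... | inj₁ u∈Q | inj₁ v∈Q = Q-clique u v u∈Q v∈Q u≢v
  ... | inj₁ u∈Q | inj₂ refl = Edge-sym (a→Q u u∈Q)
  ... | inj₂ refl | inj₁ v∈Q = a→Q v v∈Q
  ... | inj₂ refl | inj₂ refl = ⊥-elim (u≢v refl)

module Greedy {n : ℕ} (G : Graph n) (P6-free : P6Free G) {X A B : Subset n}
  (A-full : IsFullComponent G X A) (B-full : IsFullComponent G X B) (A≢B : A ≢ B) where

  A-connected : ∀ u v → u ∈ A → v ∈ A → WalkIn G A u v
  A-connected = let ((_ , _ , connected , _) , _) = A-full in connected

  B≁A : ∀ {b a} → b ∈ B → a ∈ A → ¬ Edge G b a
  B≁A = components-anticomplete G (proj₁ B-full) (proj₁ A-full) (A≢B ∘ sym)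

  -- b₂ b₁ y p q a would be an induced P6.
  no-P4-into-A : ∀ {y p q a} → HangingEdge G B y → p ∈ A → q ∈ A → a ∈ A →
    ¬ IsInducedPath G (y ∷ p ∷ q ∷ a ∷ [])
  no-P4-into-A (b₁ , b₂ , b₁∈B , b₂∈B , y~b₁ , b₁~b₂ , y≁b₂) p∈A q∈A a∈A ypqa =
    P6-free (inducedP6 G
      (step (Edge-sym G b₁~b₂) (y≁b₂ ∘ Edge-sym G ∷ B≁A b₂∈B p∈A ∷ B≁A b₂∈B q∈A ∷ B≁A b₂∈B a∈A ∷ [])
      (step (Edge-sym G y~b₁) (B≁A b₁∈B p∈A ∷ B≁A b₁∈B q∈A ∷ B≁A b₁∈B a∈A ∷ [])
      ypqa)))

  WithinTwo : Fin n → Fin n → Set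
  WithinTwo y a = Edge G y a ⊎ ∃ λ r → r ∈ A × Edge G y r × Edge G r a

  withinTwo? : ∀ y a → Dec (WithinTwo y a)
  withinTwo? y a = Edge? G y a ⊎-dec any? λ r → (r ∈? A) ×-dec Edge? G y r ×-dec Edge? G r a

  -- Walk inside A from a neighbour of y towards a; where the walk first leaves distance two
  -- from y, the last two steps and y form an induced P4.
  withinTwo : ∀ {y} → y ∈ X → HangingEdge G B y → ∀ {a} → a ∈ A → WithinTwo y a
  withinTwo {y} y∈X hanging {a} a∈A with withinTwo? y a | proj₂ A-full y y∈X
  ... | yes near | _ = near
  ... | no far | p , p∈A , y~p
    with walk-exit G (WithinTwo y) (withinTwo? y) (A-connected p a p∈A a∈A) (inj₁ y~p) far
  ... | w , w′ , w∈A , w′∈A , w~w′ , near , far′ = contradiction near w-not-near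
    where
    w-not-near : ¬ WithinTwo y w
    w-not-near (inj₁ y~w) = far′ (inj₂ (w , w∈A , y~w , w~w′))
    w-not-near (inj₂ (r , r∈A , y~r , r~w)) with Edge? G y w
    ... | yes y~w = far′ (inj₂ (w , w∈A , y~w , w~w′))
    ... | no y≁w = no-P4-into-A hanging r∈A w∈A w′∈A
      (step y~r (y≁w ∷ far′ ∘ inj₁ ∷ [])
      (step r~w (far′ ∘ inj₂ ∘ (r ,_) ∘ (r∈A ,_) ∘ (y~r ,_) ∷ [])
      (step w~w′ [] [ w′ ])))

  Unresolved : Subset n → Fin n → Set
  Unresolved Q y = y ∈ X × ¬ InNbhd G Q y × ∃ λ b → b ∈ B × ¬ Edge G y b

  unresolved? : ∀ Q y → Dec (Unresolved Q y)
  unresolved? Q y = (y ∈? X) ×-dec ¬? (inNbhd? G Q y) ×-dec any? λ b → (b ∈? B) ×-dec ¬? (Edge? G y b)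

  Resolved : Subset n → Set
  Resolved Q = ∀ x → x ∈ X → ¬ InNbhd G Q x → ∀ b → b ∈ B → Edge G x b

  record Candidate (Q : Subset n) : Set where
    field
      Q⊆A : Q ⊆ A
      clique : IsClique G Q
      extendable : ∀ {y} → Unresolved Q y → ∃ λ p → p ∈ A × Edge G y p × CompleteTo G Q p

  open Candidate public

  candidate-⊥ : Candidate ⊥
  candidate-⊥ = record
    { Q⊆A = ⊥-elim ∘ ∉⊥
    ; clique = λ _ _ u∈⊥ → ⊥-elim (∉⊥ u∈⊥)
    ; extendable = λ (y∈X , _) → let (p , p∈A , y~p) = proj₂ A-full _ y∈X in p , p∈A , y~p , λ _ → ⊥-elim ∘ ∉⊥
    }

  -- If p is not adjacent to a, then a nonempty Q yields the induced P4 y p q a (q ∈ Q),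
  -- while for empty Q any r ∈ A with y ~ r ~ a will do.
  extend : ∀ {Q a y p} → Q ⊆ A → a ∈ A → CompleteTo G Q a → y ∈ X → HangingEdge G B y →
    ¬ InNbhd G Q y → ¬ Edge G y a → p ∈ A → Edge G y p → CompleteTo G Q p →
    ∃ λ p′ → p′ ∈ A × Edge G y p′ × CompleteTo G (Q ∪ ⁅ a ⁆) p′
  extend {Q} {a} {y} {p} Q⊆A a∈A a→Q y∈X hanging y∉N y≁a p∈A y~p p→Q with Edge? G p a | nonempty? Q
  ... | yes p~a | _ = p , p∈A , y~p , completeTo-∪⁅⁆ G p→Q p~a
  ... | no p≁a | yes (q , q∈Q) = ⊥-elim (no-P4-into-A hanging p∈A (Q⊆A q∈Q) a∈A
    (step y~p (y≁q ∷ y≁a ∷ [])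
    (step (p→Q q q∈Q) (p≁a ∷ [])
    (step (Edge-sym G (a→Q q q∈Q)) [] [ a ]))))
    where
    y≁q : ¬ Edge G y q
    y≁q y~q = y∉N (q , q∈Q , y~q)
  ... | no _ | no Q-empty with withinTwo y∈X hanging a∈A
  ...   | inj₁ y~a = ⊥-elim (y≁a y~a)
  ...   | inj₂ (r , r∈A , y~r , r~a) =
    r , r∈A , y~r , completeTo-∪⁅⁆ G (λ q q∈Q → ⊥-elim (Q-empty (q , q∈Q))) r~a

  grow : ∀ {Q y₀} → Candidate Q → Unresolved Q y₀ → ∃ λ Q′ → Candidate Q′ × Q ⊂ Q′
  grow {Q} cand unresolved₀@(_ , y₀∉N , _) with extendable cand unresolved₀
  ... | a , a∈A , y₀~a , a→Q = Q ∪ ⁅ a ⁆ , cand′ , ⊂-∪⁅⁆ λ a∈Q → y₀∉N (a , a∈Q , y₀~a)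
    where
    cand′ : Candidate (Q ∪ ⁅ a ⁆)
    Q⊆A cand′ q∈Q∪a = [ Q⊆A cand , (λ { refl → a∈A }) ]′ (∈-∪⁅⁆⁻ q∈Q∪a)
    clique cand′ = isClique-∪⁅⁆ G (clique cand) a→Q
    extendable cand′ (y∈X , y∉N , b , b∈B , y≁b) =
      let (y∉NQ , y≁a) = ∉N-∪⁅⁆⁻ G y∉N
          (p , p∈A , y~p , p→Q) = extendable cand (y∈X , y∉NQ , b , b∈B , y≁b)
      in extend (Q⊆A cand) a∈A a→Q y∈X (hangingEdge G B-full y∈X b∈B y≁b) y∉NQ y≁a p∈A y~p p→Q

  resolve-or-grow : ∀ Q → Candidate Q → Resolved Q ⊎ ∃ λ Q′ → Candidate Q′ × Q ⊂ Q′
  resolve-or-grow Q cand with any? (unresolved? Q)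
  ... | yes (_ , unresolved) = inj₂ (grow cand unresolved)
  ... | no none = inj₁ λ x x∈X x∉N b b∈B →
    decidable-stable (Edge? G x b) λ x≁b → none (x , x∈X , x∉N , b , b∈B , x≁b)

lemma8 : ∀ {n : ℕ} (G : Graph n) (k : ℕ) (X A B : Subset n) →
    P6Free G → CliqueNumber G k → 2 ≤ k →
    IsMinimalSeparator G X →
    IsFullComponent G X A → IsFullComponent G X B → A ≢ B →
    Σ (Subset n) λ Q → Q ⊆ A × ∣ Q ∣ ≤ k ×
    (∀ x → x ∈ X → ¬ InNbhd G Q x → ∀ b → b ∈ B → Edge G x b)
lemma8 G k X A B P6-free (_ , clique-bound) _ _ A-full B-full A≢B =
  let (Q , cand , resolved) = saturate resolve-or-grow ⊥ candidate-⊥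
  in Q , Q⊆A cand , clique-bound Q (clique cand) , resolved
  where open Greedy G P6-free A-full B-full A≢B
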